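{- Let $(\mathcal{S},\mathcal{E})$ be a set cover instance in which every set has at most $s$ elements and every element lies in at most $t$ sets, with $s\ge 2$ and $t\ge 2$. Then the base algorithm (described in the context) returns a valid set cover, i.e., every element of $\mathcal{E}$ is contained in some set of the returned family $\mathcal{S}_{\mathrm{cvr}}$.
   Context: A set cover instance consists of a universe $\mathcal{E}$ of $n$ elements and a family $\mathcal{S}$ of subsets of $\mathcal{E}$ whose union is $\mathcal{E}$. All logarithms are base $2$, and $\log s$, $\log t$ are treated as integers. The base algorithm: start with $\mathcal{S}_{\mathrm{cvr}}=\emptyset$. For stage $i=1,\dots,\log s$, and within each stage for iteration $k=1,\dots,\log t$: for every set $S\in\mathcal{S}$ simultaneously, let $d(S)$ be the number of elements of $S$ not covered by $\mathcal{S}_{\mathrm{cvr}}$ at the beginning of the iteration (the "free" elements); if $d(S)\ge s/2^i$, add $S$ to $\mathcal{S}_{\mathrm{cvr}}$ independently with probability $2^k/t$. Finally return $\mathcal{S}_{\mathrm{cvr}}$. -}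

module Defs where

open import Data.Nat using (ℕ; zero; suc; _+_; _*_; _^_; _≤ᵇ_; _≤_)
open import Relation.Binary.PropositionalEquality using (_≡_)
open import Data.Nat.Logarithm using (⌈log₂_⌉)
open import Data.Bool using (Bool; true; false; _∧_; _∨_)
open import Data.Fin using (Fin; zero; suc)
open import Data.Fin.Subset using (Subset; _∩_; ∁; ∣_∣)
open import Data.Vec using (tabulate; lookup)
open import Data.List using (List; map; upTo; foldl)

-- A set cover instance: universe Fin n, family of m sets S : Fin m → Subset n.

anyᵇ : {m : ℕ} → (Fin m → Bool) → Bool
anyᵇ {zero}  f = false
anyᵇ {suc m} f = f zero ∨ anyᵇ (λ j → f (suc j))

setsContaining : {n m : ℕ} → (Fin m → Subset n) → Fin n → Subset m
setsContaining S e = tabulate (λ j → lookup (S j) e)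

covered : {n m : ℕ} → (Fin m → Subset n) → Subset m → Subset n
covered S cvr = tabulate (λ e → anyᵇ (λ j → lookup cvr j ∧ lookup (S j) e))

freeCount : {n m : ℕ} → (Fin m → Subset n) → Subset m → Fin m → ℕ
freeCount S cvr j = ∣ S j ∩ ∁ (covered S cvr) ∣

-- d(S_j) ≥ s / 2^i   (as rationals)  ⟺  s ≤ d(S_j) * 2^i
eligible : {n m : ℕ} → ℕ → (Fin m → Subset n) → Subset m → ℕ → Fin m → Bool
eligible s S cvr i j = s ≤ᵇ freeCount S cvr j * 2 ^ i

-- Outcomes of the random coins: coin i k j = true iff, in stage i, iteration k,
-- the coin (with success probability min(1, 2^k/t)) for set j came up "add".
Coins : ℕ → Set
Coins m = ℕ → ℕ → Fin m → Bool

-- A coin outcome is possible (has positive probability of being consistent)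
-- unless the success probability 2^k/t is ≥ 1, in which case the coin must be true.
-- (2^k/t > 0 always, so "false" is possible whenever 2^k < t.)
PossibleCoins : {m : ℕ} → ℕ → Coins m → Set
PossibleCoins {m} t coin = (i k : ℕ) (j : Fin m) → t ≤ 2 ^ k → coin i k j ≡ true

step : {n m : ℕ} → ℕ → (Fin m → Subset n) → Coins m → ℕ → ℕ → Subset m → Subset m
step s S coin i k cvr =
  tabulate (λ j → lookup cvr j ∨ (eligible s S cvr i j ∧ coin i k j))

stage : {n m : ℕ} → ℕ → ℕ → (Fin m → Subset n) → Coins m → Subset m → ℕ → Subset m
stage s t S coin cvr i = foldl (λ c k → step s S coin i k c) cvr (map suc (upTo ⌈log₂ t ⌉))

baseAlgorithm : {n m : ℕ} → ℕ → ℕ → (Fin m → Subset n) → Coins m → Subset m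
baseAlgorithm s t S coin =
  foldl (stage s t S coin) (tabulate (λ _ → false)) (map suc (upTo ⌈log₂ s ⌉))

module Submission where

-- Adding sets never removes any, so once an element is covered it
-- stays covered. In the last iteration k = ⌈log₂ t⌉ of the last stage
-- i = ⌈log₂ s⌉ we have t ≤ 2^k, so every coin comes up "add", and
-- s ≤ 2^i, so the threshold s/2^i is at most 1. Hence a set containing a
-- still uncovered element e has at least one free element, is eligible,
-- and is added: after that iteration e is covered, and it stays covered.

open import Defs
open import Data.Nat using (ℕ; _≤_)
open import Data.Fin using (Fin)
open import Data.Fin.Subset using (Subset; _∈_; ∣_∣)
open import Data.Product using (∃-syntax; _×_)

open import Level using (Level)
open import Data.Nat using (zero; suc; _+_; _*_; _^_; _<_; z≤n; s≤s; ⌈_/2⌉)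
open import Data.Nat.Properties
  using (≤-trans; +-monoˡ-≤; +-mono-≤; +-suc; +-identityʳ; *-identityˡ; *-monoˡ-≤; n<1+n;
         ⌊n/2⌋≤⌈n/2⌉; ⌊n/2⌋+⌈n/2⌉≡n; ⌈n/2⌉<n; ≤⇒≤ᵇ; module ≤-Reasoning)
open import Data.Nat.Logarithm using (⌈log₂_⌉; ⌈log₂⌉-mono-≤)
open import Data.Nat.Logarithm.Core using (⌈log2⌉)
open import Data.Nat.Induction using (<-wellFounded)
open import Induction.WellFounded using (Acc; acc)
open import Data.Bool using (Bool; true; false; _∧_; _∨_)
open import Data.Bool.Properties using (∨-zeroʳ; T-≡)
open import Function.Bundles using (Equivalence)
open import Data.Fin using (zero; suc)
open import Data.Fin.Subset using (_∉_)
open import Data.Fin.Subset.Properties using (_∈?_; x∉p⇒x∈∁p; x∈p∩q⁺; x∈p⇒∣p-x∣<∣p∣)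
open import Data.Vec using (tabulate; lookup)
open import Data.Vec.Properties using (lookup∘tabulate; []=⇒lookup; lookup⇒[]=)
open import Data.List using ([]; _∷_; map; upTo; foldl)
import Data.List.Membership.Propositional as List
open import Data.List.Membership.Propositional.Properties using (∈-map⁺; ∈-upTo⁺)
open import Data.List.Relation.Unary.Any using (here; there)
open import Data.Product using (_,_)
open import Relation.Nullary using (yes; no)
open import Relation.Binary.PropositionalEquality using (_≡_; refl; sym; trans; cong; cong₂; subst; module ≡-Reasoning)

private
  variable
    a b ℓ : Level
    A : Set a
    B : Set b

∈-tabulate⁺ : ∀ {n} {f : Fin n → Bool} {x : Fin n} → f x ≡ true → x ∈ tabulate f
∈-tabulate⁺ {f = f} {x} fx = lookup⇒[]= x (tabulate f) (trans (lookup∘tabulate f x) fx)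

∈-tabulate⁻ : ∀ {n} {f : Fin n → Bool} {x : Fin n} → x ∈ tabulate f → f x ≡ true
∈-tabulate⁻ {f = f} {x} x∈ = trans (sym (lookup∘tabulate f x)) ([]=⇒lookup x∈)

anyᵇ-witness : ∀ {m} (f : Fin m → Bool) → anyᵇ f ≡ true → ∃[ j ] (f j ≡ true)
anyᵇ-witness {zero} f ()
anyᵇ-witness {suc m} f found with f zero in f0
... | true  = zero , f0
... | false with anyᵇ-witness (λ j → f (suc j)) found
...   | j , fj = suc j , fj

∧-true⁻ : ∀ {x y : Bool} → x ∧ y ≡ true → x ≡ true × y ≡ true
∧-true⁻ {true} {true} _ = refl , refl

∈⇒1≤∣p∣ : ∀ {n} {x : Fin n} {p : Subset n} → x ∈ p → 1 ≤ ∣ p ∣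
∈⇒1≤∣p∣ x∈p = ≤-trans (s≤s z≤n) (x∈p⇒∣p-x∣<∣p∣ x∈p)

n≤⌈n/2⌉+⌈n/2⌉ : ∀ n → n ≤ ⌈ n /2⌉ + ⌈ n /2⌉
n≤⌈n/2⌉+⌈n/2⌉ n = subst (_≤ ⌈ n /2⌉ + ⌈ n /2⌉) (⌊n/2⌋+⌈n/2⌉≡n n)
  (+-monoˡ-≤ ⌈ n /2⌉ (⌊n/2⌋≤⌈n/2⌉ n))

-- The ceiling logarithm is an upper logarithm: n ≤ 2^⌈log₂ n⌉. The proof
-- follows the recursion ⌈log₂ (2 + n)⌉ = 1 + ⌈log₂ (1 + ⌈n/2⌉)⌉.
≤2^⌈log2⌉ : ∀ n (rec : Acc _<_ n) → n ≤ 2 ^ ⌈log2⌉ n rec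
≤2^⌈log2⌉ zero _ = z≤n
≤2^⌈log2⌉ (suc zero) _ = s≤s z≤n
≤2^⌈log2⌉ (suc (suc n)) (acc rs) = begin
  suc (suc n)                       ≤⟨ s≤s (s≤s (n≤⌈n/2⌉+⌈n/2⌉ n)) ⟩
  suc (suc (⌈ n /2⌉ + ⌈ n /2⌉))     ≡⟨ cong suc (sym (+-suc ⌈ n /2⌉ ⌈ n /2⌉)) ⟩
  suc ⌈ n /2⌉ + suc ⌈ n /2⌉         ≤⟨ +-mono-≤ ih ih ⟩
  h + h                             ≡⟨ cong (h +_) (sym (+-identityʳ h)) ⟩
  2 * h                             ∎
  where
  open ≤-Reasoning
  h : ℕ
  h = 2 ^ ⌈log2⌉ (suc ⌈ n /2⌉) (rs (⌈n/2⌉<n n))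
  ih : suc ⌈ n /2⌉ ≤ h
  ih = ≤2^⌈log2⌉ (suc ⌈ n /2⌉) (rs (⌈n/2⌉<n n))

≤2^⌈log₂⌉ : ∀ n → n ≤ 2 ^ ⌈log₂ n ⌉
≤2^⌈log₂⌉ n = ≤2^⌈log2⌉ n (<-wellFounded n)

last∈range : ∀ L → 1 ≤ L → L List.∈ map suc (upTo L)
last∈range (suc L) _ = ∈-map⁺ suc (∈-upTo⁺ (n<1+n L))

1≤⌈log₂⌉ : ∀ {n} → 2 ≤ n → 1 ≤ ⌈log₂ n ⌉
1≤⌈log₂⌉ 2≤n = ⌈log₂⌉-mono-≤ 2≤n

foldl-invariant : (f : A → B → A) (P : A → Set ℓ) → (∀ x y → P x → P (f x y))
  → ∀ ys x → P x → P (foldl f x ys)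
foldl-invariant f P pres [] x px = px
foldl-invariant f P pres (y ∷ ys) x px = foldl-invariant f P pres ys (f x y) (pres x y px)

foldl-established : (f : A → B → A) (P : A → Set ℓ) → (∀ x y → P x → P (f x y))
  → (y : B) → (∀ x → P (f x y)) → ∀ {ys} → y List.∈ ys → ∀ x → P (foldl f x ys)
foldl-established f P pres y est {_ ∷ ys} (here refl) x = foldl-invariant f P pres ys (f x y) (est x)
foldl-established f P pres y est {z ∷ ys} (there y∈) x = foldl-established f P pres y est y∈ (f x z)

module _ {n m : ℕ} (s : ℕ) (S : Fin m → Subset n) (coin : Coins m) where

  Covers : Fin n → Subset m → Set
  Covers e cvr = ∃[ j ] (j ∈ cvr × e ∈ S j)

  step-keeps : ∀ i k {cvr j} → j ∈ cvr → j ∈ step s S coin i k cvr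
  step-keeps i k {cvr} {j} j∈ =
    ∈-tabulate⁺ (cong (_∨ (eligible s S cvr i j ∧ coin i k j)) ([]=⇒lookup j∈))

  step-adds : ∀ i k {cvr j} → eligible s S cvr i j ≡ true → coin i k j ≡ true
    → j ∈ step s S coin i k cvr
  step-adds i k {cvr} {j} el heads = ∈-tabulate⁺ (begin
    lookup cvr j ∨ (eligible s S cvr i j ∧ coin i k j) ≡⟨ cong₂ (λ x y → lookup cvr j ∨ (x ∧ y)) el heads ⟩
    lookup cvr j ∨ true                                 ≡⟨ ∨-zeroʳ (lookup cvr j) ⟩
    true                                                ∎)
    where open ≡-Reasoning

  step-preserves : ∀ i k {cvr} e → Covers e cvr → Covers e (step s S coin i k cvr)
  step-preserves i k e (j , j∈ , e∈) = j , step-keeps i k j∈ , e∈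

  stage-preserves : ∀ t {cvr} e i → Covers e cvr → Covers e (stage s t S coin cvr i)
  stage-preserves t {cvr} e i =
    foldl-invariant (λ c k → step s S coin i k c) (Covers e)
      (λ _ k → step-preserves i k e) (map suc (upTo ⌈log₂ t ⌉)) cvr

  covered⇒Covers : ∀ {cvr e} → e ∈ covered S cvr → Covers e cvr
  covered⇒Covers {cvr} {e} e∈ with anyᵇ-witness _ (∈-tabulate⁻ e∈)
  ... | j , found with ∧-true⁻ found
  ...   | chosen , contains = j , lookup⇒[]= j cvr chosen , lookup⇒[]= e (S j) contains

  free⇒eligible : ∀ i {cvr j e} → s ≤ 2 ^ i → e ∈ S j → e ∉ covered S cvr
    → eligible s S cvr i j ≡ true
  free⇒eligible i {cvr} {j} s≤2^i e∈ e∉ = Equivalence.to T-≡ (≤⇒≤ᵇ (begin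
    s                                ≤⟨ s≤2^i ⟩
    2 ^ i                            ≡⟨ sym (*-identityˡ (2 ^ i)) ⟩
    1 * 2 ^ i                        ≤⟨ *-monoˡ-≤ (2 ^ i) one-free ⟩
    freeCount S cvr j * 2 ^ i        ∎))
    where
    open ≤-Reasoning
    one-free : 1 ≤ freeCount S cvr j
    one-free = ∈⇒1≤∣p∣ (x∈p∩q⁺ (e∈ , x∉p⇒x∈∁p e∉))

  step-covers : ∀ i k cvr e → s ≤ 2 ^ i → (∀ j → coin i k j ≡ true)
    → ∃[ j ] (e ∈ S j) → Covers e (step s S coin i k cvr)
  step-covers i k cvr e s≤2^i heads (j , e∈) with e ∈? covered S cvr
  ... | yes e∈cvr = step-preserves i k e (covered⇒Covers {cvr} e∈cvr)
  ... | no  e∉cvr = j , step-adds i k {cvr} (free⇒eligible i {cvr} s≤2^i e∈ e∉cvr) (heads j) , e∈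

-- Validity of the cover. The bounds on set sizes and element degrees are
-- only needed for the approximation guarantee, not for validity.
lemma3p1 : (n m s t : ℕ) (S : Fin m → Subset n)
    → 2 ≤ s → 2 ≤ t
    → (∀ j → ∣ S j ∣ ≤ s)
    → (∀ e → ∣ setsContaining S e ∣ ≤ t)
    → (∀ e → ∃[ j ] (e ∈ S j))
    → (coin : Coins m) → PossibleCoins t coin
    → ∀ e → ∃[ j ] (j ∈ baseAlgorithm s t S coin × e ∈ S j)
lemma3p1 n m s t S 2≤s 2≤t _ _ cover coin possible e =
  foldl-established (stage s t S coin) (Covers s S coin e)
    (λ _ i → stage-preserves s S coin t e i) i-last
    covered-in-last-stage (last∈range i-last (1≤⌈log₂⌉ 2≤s)) (tabulate (λ _ → false))
  where
  i-last k-last : ℕ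
  i-last = ⌈log₂ s ⌉
  k-last = ⌈log₂ t ⌉
  covered-in-last-stage : ∀ cvr → Covers s S coin e (stage s t S coin cvr i-last)
  covered-in-last-stage =
    foldl-established (λ c k → step s S coin i-last k c) (Covers s S coin e)
      (λ _ k → step-preserves s S coin i-last k e) k-last
      (λ cvr → step-covers s S coin i-last k-last cvr e (≤2^⌈log₂⌉ s)
                 (λ j → possible i-last k-last j (≤2^⌈log₂⌉ t)) (cover e))
      (last∈range k-last (1≤⌈log₂⌉ 2≤t))
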